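{- Let $k,n,s$ be positive integers and let $x_1,\dots,x_n$ be independent variables. Then \[ M_{k}^{(s)}(x_{1},\ldots ,x_{n}) =\sum_{T\in \mathcal{T}^{(s)}_{n,k}}\omega(T). \]
   Context: $M_{k}^{(s)}(x_{1},\ldots,x_{n})=\sum x_{1}^{a_{1}}\cdots x_{n}^{a_{n}}$, the sum over all $n$-tuples of nonnegative integers $(a_1,\dots,a_n)$ with $a_1+\cdots+a_n=k$ and each $a_i\equiv 0$ or $1 \pmod{s+1}$. A weighted tiling is a tiling of a board of cells in a row by gray and black unit squares, in which each black square receives the weight $x_{m+1}$, where $m$ is the number of gray squares to the left of that black square. Let $\mathcal{T}^{(s)}_{n,k}$ be the set of weighted tilings of a board of length $n+k-1$ using exactly $k$ black squares and $n-1$ gray squares, such that every maximal run of consecutive black squares (including the possibly empty runs before the first gray square, between consecutive gray squares, and after the last gray square) has length congruent to $0$ or $1$ modulo $s+1$. The weight $\omega(T)$ of a tiling is the product of the weights of its black squares. -}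

module Defs where

open import Level using (Level)
open import Data.Nat using (ℕ; zero; suc; _+_; _∸_; _%_; _≡ᵇ_)
open import Data.Bool using (Bool; true; false; _∨_; _∧_)
open import Data.List using (List; []; _∷_; map; concatMap; filter; upTo)
open import Data.Bool.ListAction using (and)
open import Algebra.Bundles using (CommutativeSemiring)
open import Relation.Binary.PropositionalEquality using (_≡_)
open import Relation.Nullary.Decidable using (Dec)
open import Data.Bool.Properties using (T?)
open import Data.Bool using (T)

admissible : ℕ → ℕ → Bool
admissible s a = (a % suc s ≡ᵇ 0) ∨ (a % suc s ≡ᵇ 1)

compositions : ℕ → ℕ → List (List ℕ)
compositions zero    zero    = [] ∷ []
compositions zero    (suc k) = []
compositions (suc n) k       =
  concatMap (λ a → map (a ∷_) (compositions n (k ∸ a))) (upTo (suc k))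

admissibleCompositions : ℕ → ℕ → ℕ → List (List ℕ)
admissibleCompositions s n k =
  filter (λ as → T? (and (map (admissible s) as))) (compositions n k)

data Colour : Set where
  gray black : Colour

boards : ℕ → List (List Colour)
boards zero    = [] ∷ []
boards (suc L) = map (gray ∷_) (boards L) ++′ map (black ∷_) (boards L)
  where
  open import Data.List using () renaming (_++_ to _++′_)

blackCount : List Colour → ℕ
blackCount []            = 0
blackCount (gray  ∷ w)   = blackCount w
blackCount (black ∷ w)   = suc (blackCount w)

-- lengths of the maximal runs of black squares, including the (possibly
-- empty) runs before the first gray, between consecutive grays, and after
-- the last gray; a board with g gray squares has g+1 runs.
blackRuns : List Colour → List ℕ
blackRuns []          = 0 ∷ []
blackRuns (gray  ∷ w) = 0 ∷ blackRuns w
blackRuns (black ∷ w) with blackRuns w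
... | []     = 1 ∷ []      -- never happens
... | r ∷ rs = suc r ∷ rs

tilings : ℕ → ℕ → ℕ → List (List Colour)
tilings s n k =
  filter (λ w → T? ((blackCount w ≡ᵇ k) ∧ and (map (admissible s) (blackRuns w))))
         (boards (n + k ∸ 1))

-- Evaluation in a commutative semiring.
-- Variables are given by x : ℕ → Carrier with  x i  standing for  x_{i+1}.

module _ {c ℓ : Level} (R : CommutativeSemiring c ℓ) where
  open CommutativeSemiring R using (Carrier; 0#; 1#) renaming (_+_ to _⊕_; _*_ to _⊗_)

  sumR : List Carrier → Carrier
  sumR []       = 0#
  sumR (a ∷ as) = a ⊕ sumR as

  powR : Carrier → ℕ → Carrier
  powR a zero    = 1#
  powR a (suc e) = a ⊗ powR a e

  monomialFrom : (ℕ → Carrier) → ℕ → List ℕ → Carrier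
  monomialFrom x i []       = 1#
  monomialFrom x i (a ∷ as) = powR (x i) a ⊗ monomialFrom x (suc i) as

  M : ℕ → ℕ → ℕ → (ℕ → Carrier) → Carrier
  M s n k x = sumR (map (monomialFrom x 0) (admissibleCompositions s n k))

  -- weight of a tiling: a black square with m gray squares to its left
  -- gets weight x_{m+1}, i.e.  x m  in our 0-based indexing
  weightFrom : (ℕ → Carrier) → ℕ → List Colour → Carrier
  weightFrom x m []          = 1#
  weightFrom x m (gray  ∷ w) = weightFrom x (suc m) w
  weightFrom x m (black ∷ w) = x m ⊗ weightFrom x m w

  ω : (ℕ → Carrier) → List Colour → Carrier
  ω x = weightFrom x 0

  tilingSum : ℕ → ℕ → ℕ → (ℕ → Carrier) → Carrier
  tilingSum s n k x = sumR (map (ω x) (tilings s n k))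

-- Black runs a₁, …, aₙ separated by n − 1 gray squares form a tiling of weight x₁^a₁ ⋯ xₙ^aₙ,
-- so tilings and admissible compositions correspond bijectively with equal weights.  Instead
-- of transporting sums along this bijection, both sides are shown to satisfy one recursion:
-- compositions by splitting off the first part a, boards by reading cells from the left while
-- remembering the length c of the current black run, which yields the same sum over a shifted
-- by c.
module Submission where

open import Defs
open import Level using (Level)
open import Algebra.Bundles using (CommutativeSemiring)
open import Data.Bool using (Bool; true; false; _∧_; if_then_else_)
open import Data.Bool.ListAction using (all)
open import Data.Bool.Properties using (T?; ∧-identityʳ)
open import Data.List using (List; []; _∷_; map; filter; _++_; concatMap; applyUpTo; upTo)
open import Data.List.Properties using (map-++; map-cong)
open import Data.Nat using (ℕ; zero; suc; _+_; _∸_; _≡ᵇ_; _≤_; _<_; s≤s)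
import Data.Nat.Properties as ℕ
open import Data.Product using (∃₂; _,_)
open import Relation.Binary.PropositionalEquality as ≡ using (_≡_)

addHead : ℕ → List ℕ → List ℕ
addHead c []       = c ∷ []
addHead c (r ∷ rs) = c + r ∷ rs

blackRuns-nonEmpty : ∀ w → ∃₂ λ r rs → blackRuns w ≡ r ∷ rs
blackRuns-nonEmpty []          = 0 , [] , ≡.refl
blackRuns-nonEmpty (gray ∷ w)  = 0 , blackRuns w , ≡.refl
blackRuns-nonEmpty (black ∷ w) with blackRuns w | blackRuns-nonEmpty w
... | .(r ∷ rs) | r , rs , ≡.refl = suc r , rs , ≡.refl

addHead-zero : ∀ w → addHead 0 (blackRuns w) ≡ blackRuns w
addHead-zero w with blackRuns-nonEmpty w
... | r , rs , eq rewrite eq = ≡.refl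

addHead-black : ∀ c w → addHead c (blackRuns (black ∷ w)) ≡ addHead (suc c) (blackRuns w)
addHead-black c w with blackRuns w
... | []     = ≡.cong (_∷ []) (ℕ.+-comm c 1)
... | r ∷ rs = ≡.cong (_∷ rs) (ℕ.+-suc c r)

module Sums {c ℓ : Level} (R : CommutativeSemiring c ℓ) where
  open CommutativeSemiring R hiding (zero) renaming (_+_ to _⊕_; _*_ to _⊗_)
  open import Relation.Binary.Reasoning.Setoid setoid

  infixr 8 [_]·_

  [_]·_ : Bool → Carrier → Carrier
  [ b ]· y = if b then y else 0#

  indicator-∧ : ∀ a b y → [ a ∧ b ]· y ≡ [ a ]· [ b ]· y
  indicator-∧ true  b y = ≡.refl
  indicator-∧ false b y = ≡.refl

  indicator-swap : ∀ a b y → [ a ]· [ b ]· y ≡ [ b ]· [ a ]· y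
  indicator-swap true  true  y = ≡.refl
  indicator-swap true  false y = ≡.refl
  indicator-swap false true  y = ≡.refl
  indicator-swap false false y = ≡.refl

  indicator-zeroʳ : ∀ b → [ b ]· 0# ≡ 0#
  indicator-zeroʳ true  = ≡.refl
  indicator-zeroʳ false = ≡.refl

  indicator-cong : ∀ b {y z} → y ≈ z → [ b ]· y ≈ [ b ]· z
  indicator-cong true  y≈z = y≈z
  indicator-cong false y≈z = refl

  indicator-*ˡ : ∀ b u y → [ b ]· (u ⊗ y) ≈ u ⊗ [ b ]· y
  indicator-*ˡ true  u y = refl
  indicator-*ˡ false u y = sym (zeroʳ u)

  sumBelow : (ℕ → Carrier) → ℕ → Carrier
  sumBelow f zero    = 0#
  sumBelow f (suc n) = f 0 ⊕ sumBelow (λ a → f (suc a)) n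

  sumBelow-cong : ∀ {f g} n → (∀ a → f a ≈ g a) → sumBelow f n ≈ sumBelow g n
  sumBelow-cong zero    f≈g = refl
  sumBelow-cong (suc n) f≈g = +-cong (f≈g 0) (sumBelow-cong n (λ a → f≈g (suc a)))

  *-distribˡ-sumBelow : ∀ u f n → u ⊗ sumBelow f n ≈ sumBelow (λ a → u ⊗ f a) n
  *-distribˡ-sumBelow u f zero    = zeroʳ u
  *-distribˡ-sumBelow u f (suc n) = trans (distribˡ u _ _) (+-cong refl (*-distribˡ-sumBelow u _ n))

  module _ {A : Set} where

    sumR-cong : ∀ {f g : A → Carrier} l → (∀ a → f a ≈ g a) → sumR R (map f l) ≈ sumR R (map g l)
    sumR-cong []      f≈g = refl
    sumR-cong (a ∷ l) f≈g = +-cong (f≈g a) (sumR-cong l f≈g)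

    sumR-map : ∀ {B : Set} (f : B → Carrier) (g : A → B) l →
               sumR R (map f (map g l)) ≡ sumR R (map (λ a → f (g a)) l)
    sumR-map f g []      = ≡.refl
    sumR-map f g (a ∷ l) = ≡.cong (f (g a) ⊕_) (sumR-map f g l)

    sumR-zeros : ∀ (l : List A) → sumR R (map (λ _ → 0#) l) ≈ 0#
    sumR-zeros []      = refl
    sumR-zeros (a ∷ l) = trans (+-identityˡ _) (sumR-zeros l)

    sumR-*ˡ : ∀ u (f : A → Carrier) l → sumR R (map (λ a → u ⊗ f a) l) ≈ u ⊗ sumR R (map f l)
    sumR-*ˡ u f []      = sym (zeroʳ u)
    sumR-*ˡ u f (a ∷ l) = trans (+-cong refl (sumR-*ˡ u f l)) (sym (distribˡ u _ _))

    sumR-indicator : ∀ b (f : A → Carrier) l → sumR R (map (λ a → [ b ]· f a) l) ≈ [ b ]· sumR R (map f l)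
    sumR-indicator true  f l = refl
    sumR-indicator false f l = sumR-zeros l

    sumR-filter : ∀ (q : A → Bool) (f : A → Carrier) l →
                  sumR R (map f (filter (λ a → T? (q a)) l)) ≈ sumR R (map (λ a → [ q a ]· f a) l)
    sumR-filter q f []      = refl
    sumR-filter q f (a ∷ l) with q a
    ... | true  = +-cong refl (sumR-filter q f l)
    ... | false = trans (sumR-filter q f l) (sym (+-identityˡ _))

    sumR-applyUpTo : ∀ (f : A → Carrier) (g : ℕ → A) n →
                     sumR R (map f (applyUpTo g n)) ≡ sumBelow (λ a → f (g a)) n
    sumR-applyUpTo f g zero    = ≡.refl
    sumR-applyUpTo f g (suc n) = ≡.cong (f (g 0) ⊕_) (sumR-applyUpTo f (λ a → g (suc a)) n)

  sumR-++ : ∀ xs ys → sumR R (xs ++ ys) ≈ sumR R xs ⊕ sumR R ys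
  sumR-++ []       ys = sym (+-identityˡ _)
  sumR-++ (a ∷ xs) ys = trans (+-cong refl (sumR-++ xs ys)) (sym (+-assoc _ _ _))

  sumR-concatMap : ∀ {A B : Set} (f : B → Carrier) (g : A → List B) l →
                   sumR R (map f (concatMap g l)) ≈ sumR R (map (λ a → sumR R (map f (g a))) l)
  sumR-concatMap f g []      = refl
  sumR-concatMap f g (a ∷ l) = begin
    sumR R (map f (g a ++ concatMap g l))                  ≡⟨ ≡.cong (sumR R) (map-++ f (g a) (concatMap g l)) ⟩
    sumR R (map f (g a) ++ map f (concatMap g l))          ≈⟨ sumR-++ (map f (g a)) _ ⟩
    sumR R (map f (g a)) ⊕ sumR R (map f (concatMap g l))  ≈⟨ +-cong refl (sumR-concatMap f g l) ⟩
    sumR R (map (λ a → sumR R (map f (g a))) (a ∷ l)) ∎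

module Tilings {c ℓ : Level} (R : CommutativeSemiring c ℓ) (p : ℕ → Bool)
               (x : ℕ → CommutativeSemiring.Carrier R) where
  open CommutativeSemiring R hiding (zero) renaming (_+_ to _⊕_; _*_ to _⊗_)
  open import Relation.Binary.Reasoning.Setoid setoid
  open Sums R

  infixr 8 _^_

  _^_ : Carrier → ℕ → Carrier
  _^_ = powR R

  compositionSum : ℕ → ℕ → ℕ → Carrier
  compositionSum n k m = sumR R (map (λ as → [ all p as ]· monomialFrom R x m as) (compositions n k))

  -- Compositions of k into n + 1 parts whose first part a is tested as the run length c + a.
  offsetSum : ℕ → ℕ → ℕ → ℕ → Carrier
  offsetSum n k c m = sumBelow (λ a → [ p (c + a) ]· (x m ^ a ⊗ compositionSum n (k ∸ a) (suc m))) (suc k)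

  compositionSum-nil : ∀ m → compositionSum 0 0 m ≈ 1#
  compositionSum-nil m = +-identityʳ 1#

  compositionSum-suc : ∀ n k m → compositionSum (suc n) k m ≈ offsetSum n k 0 m
  compositionSum-suc n k m = begin
    compositionSum (suc n) k m
      ≈⟨ sumR-concatMap term (λ a → map (a ∷_) (compositions n (k ∸ a))) (upTo (suc k)) ⟩
    sumR R (map (λ a → sumR R (map term (map (a ∷_) (compositions n (k ∸ a))))) (upTo (suc k)))
      ≡⟨ sumR-applyUpTo _ (λ a → a) (suc k) ⟩
    sumBelow (λ a → sumR R (map term (map (a ∷_) (compositions n (k ∸ a))))) (suc k)
      ≈⟨ sumBelow-cong (suc k) firstPart ⟩
    offsetSum n k 0 m ∎
    where
    term : List ℕ → Carrier
    term as = [ all p as ]· monomialFrom R x m as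

    firstPart : ∀ a → sumR R (map term (map (a ∷_) (compositions n (k ∸ a))))
                    ≈ [ p a ]· (x m ^ a ⊗ compositionSum n (k ∸ a) (suc m))
    firstPart a = begin
      sumR R (map term (map (a ∷_) (compositions n (k ∸ a))))
        ≡⟨ sumR-map term (a ∷_) parts ⟩
      sumR R (map (λ as → term (a ∷ as)) parts)
        ≈⟨ sumR-cong parts splitHead ⟩
      sumR R (map (λ as → [ p a ]· (x m ^ a ⊗ [ all p as ]· monomialFrom R x (suc m) as)) parts)
        ≈⟨ sumR-indicator (p a) (λ as → x m ^ a ⊗ [ all p as ]· monomialFrom R x (suc m) as) parts ⟩
      [ p a ]· sumR R (map (λ as → x m ^ a ⊗ [ all p as ]· monomialFrom R x (suc m) as) (compositions n (k ∸ a)))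
        ≈⟨ indicator-cong (p a) (sumR-*ˡ (x m ^ a) (λ as → [ all p as ]· monomialFrom R x (suc m) as) parts) ⟩
      [ p a ]· (x m ^ a ⊗ compositionSum n (k ∸ a) (suc m)) ∎
      where
      parts : List (List ℕ)
      parts = compositions n (k ∸ a)

      splitHead : ∀ as → term (a ∷ as) ≈ [ p a ]· (x m ^ a ⊗ [ all p as ]· monomialFrom R x (suc m) as)
      splitHead as = trans (reflexive (indicator-∧ (p a) (all p as) _))
                           (indicator-cong (p a) (indicator-*ˡ (all p as) (x m ^ a) _))

  offsetSum-zero : ∀ n c m → offsetSum n 0 c m ≈ [ p (c + 0) ]· compositionSum n 0 (suc m)
  offsetSum-zero n c m = trans (+-identityʳ _) (indicator-cong (p (c + 0)) (*-identityˡ _))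

  offsetSum-suc : ∀ n k c m →
    offsetSum n (suc k) c m ≈ [ p (c + 0) ]· compositionSum n (suc k) (suc m) ⊕ x m ⊗ offsetSum n k (suc c) m
  offsetSum-suc n k c m =
    +-cong (indicator-cong (p (c + 0)) (*-identityˡ _))
           (sym (trans (*-distribˡ-sumBelow (x m) term (suc k)) (sumBelow-cong (suc k) shift)))
    where
    term : ℕ → Carrier
    term a = [ p (suc c + a) ]· (x m ^ a ⊗ compositionSum n (k ∸ a) (suc m))

    shift : ∀ a → x m ⊗ term a
                ≈ [ p (c + suc a) ]· (x m ^ suc a ⊗ compositionSum n (k ∸ a) (suc m))
    shift a rewrite ℕ.+-suc c a =
      trans (sym (indicator-*ˡ (p (suc c + a)) _ _)) (indicator-cong (p (suc c + a)) (sym (*-assoc _ _ _)))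

  -- c is the length of the black run that has already been read to the left of the board.
  boardTerm : ℕ → ℕ → ℕ → List Colour → Carrier
  boardTerm k c m w = [ (blackCount w ≡ᵇ k) ∧ all p (addHead c (blackRuns w)) ]· weightFrom R x m w

  boardSum : ℕ → ℕ → ℕ → ℕ → Carrier
  boardSum L k c m = sumR R (map (boardTerm k c m) (boards L))

  boardTerm-gray : ∀ k c m w → boardTerm k c m (gray ∷ w) ≡ [ p (c + 0) ]· boardTerm k 0 (suc m) w
  boardTerm-gray k c m w
    rewrite addHead-zero w
          | indicator-∧ (blackCount w ≡ᵇ k) (p (c + 0) ∧ all p (blackRuns w)) (weightFrom R x (suc m) w)
          | indicator-∧ (p (c + 0)) (all p (blackRuns w)) (weightFrom R x (suc m) w)
          | indicator-∧ (blackCount w ≡ᵇ k) (all p (blackRuns w)) (weightFrom R x (suc m) w)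
          = indicator-swap (blackCount w ≡ᵇ k) (p (c + 0)) _

  boardTerm-black : ∀ k c m w → boardTerm (suc k) c m (black ∷ w) ≈ x m ⊗ boardTerm k (suc c) m w
  boardTerm-black k c m w rewrite addHead-black c w =
    indicator-*ˡ ((blackCount w ≡ᵇ k) ∧ all p (addHead (suc c) (blackRuns w))) (x m) _

  sumR-boards-suc : ∀ (f : List Colour → Carrier) L →
    sumR R (map f (boards (suc L))) ≈ sumR R (map (λ w → f (gray ∷ w)) (boards L)) ⊕ sumR R (map (λ w → f (black ∷ w)) (boards L))
  sumR-boards-suc f L = begin
    sumR R (map f (map (gray ∷_) (boards L) ++ map (black ∷_) (boards L)))
      ≡⟨ ≡.cong (sumR R) (map-++ f (map (gray ∷_) (boards L)) _) ⟩
    sumR R (map f (map (gray ∷_) (boards L)) ++ map f (map (black ∷_) (boards L)))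
      ≈⟨ sumR-++ (map f (map (gray ∷_) (boards L))) _ ⟩
    sumR R (map f (map (gray ∷_) (boards L))) ⊕ sumR R (map f (map (black ∷_) (boards L)))
      ≡⟨ ≡.cong₂ _⊕_ (sumR-map f (gray ∷_) (boards L)) (sumR-map f (black ∷_) (boards L)) ⟩
    sumR R (map (λ w → f (gray ∷ w)) (boards L)) ⊕ sumR R (map (λ w → f (black ∷ w)) (boards L)) ∎

  boardSum-gray : ∀ L k c m →
    sumR R (map (λ w → boardTerm k c m (gray ∷ w)) (boards L)) ≈ [ p (c + 0) ]· boardSum L k 0 (suc m)
  boardSum-gray L k c m = begin
    sumR R (map (λ w → boardTerm k c m (gray ∷ w)) (boards L))
      ≡⟨ ≡.cong (sumR R) (map-cong (boardTerm-gray k c m) (boards L)) ⟩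
    sumR R (map (λ w → [ p (c + 0) ]· boardTerm k 0 (suc m) w) (boards L))
      ≈⟨ sumR-indicator (p (c + 0)) _ (boards L) ⟩
    [ p (c + 0) ]· boardSum L k 0 (suc m) ∎

  boardSum-nil : ∀ c m → boardSum 0 0 c m ≈ [ p (c + 0) ]· 1#
  boardSum-nil c m rewrite ∧-identityʳ (p (c + 0)) = +-identityʳ _

  boardSum-suc-zero : ∀ L c m → boardSum (suc L) 0 c m ≈ [ p (c + 0) ]· boardSum L 0 0 (suc m)
  boardSum-suc-zero L c m =
    trans (sumR-boards-suc (boardTerm 0 c m) L)
          (trans (+-cong (boardSum-gray L 0 c m) (sumR-zeros (boards L))) (+-identityʳ _))

  boardSum-suc-suc : ∀ L k c m →
    boardSum (suc L) (suc k) c m ≈ [ p (c + 0) ]· boardSum L (suc k) 0 (suc m) ⊕ x m ⊗ boardSum L k (suc c) m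
  boardSum-suc-suc L k c m =
    trans (sumR-boards-suc (boardTerm (suc k) c m) L)
          (+-cong (boardSum-gray L (suc k) c m)
                  (trans (sumR-cong (boards L) (boardTerm-black k c m)) (sumR-*ˡ (x m) _ (boards L))))

  boardSum-short : ∀ L k c m → L < k → boardSum L k c m ≈ 0#
  boardSum-short zero    (suc k) c m _ = +-identityʳ 0#
  boardSum-short (suc L) (suc k) c m (s≤s L<k) = begin
    boardSum (suc L) (suc k) c m
      ≈⟨ boardSum-suc-suc L k c m ⟩
    [ p (c + 0) ]· boardSum L (suc k) 0 (suc m) ⊕ x m ⊗ boardSum L k (suc c) m
      ≈⟨ +-cong (indicator-cong (p (c + 0)) (boardSum-short L (suc k) 0 (suc m) (ℕ.m≤n⇒m≤1+n L<k)))
                (*-congˡ (boardSum-short L k (suc c) m L<k)) ⟩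
    [ p (c + 0) ]· 0# ⊕ x m ⊗ 0#
      ≡⟨ ≡.cong (_⊕ x m ⊗ 0#) (indicator-zeroʳ (p (c + 0))) ⟩
    0# ⊕ x m ⊗ 0#
      ≈⟨ trans (+-identityˡ _) (zeroʳ (x m)) ⟩
    0# ∎

  boardSum≈offsetSum-suc : ∀ j k c m →
    boardSum (k + j) (suc k) 0 (suc m) ≈ compositionSum j (suc k) (suc m) →
    boardSum (k + j) k (suc c) m ≈ offsetSum j k (suc c) m →
    boardSum (suc k + j) (suc k) c m ≈ offsetSum j (suc k) c m
  boardSum≈offsetSum-suc j k c m grayFirst blackFirst = begin
    boardSum (suc k + j) (suc k) c m
      ≈⟨ boardSum-suc-suc (k + j) k c m ⟩
    [ p (c + 0) ]· boardSum (k + j) (suc k) 0 (suc m) ⊕ x m ⊗ boardSum (k + j) k (suc c) m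
      ≈⟨ +-cong (indicator-cong (p (c + 0)) grayFirst) (*-congˡ blackFirst) ⟩
    [ p (c + 0) ]· compositionSum j (suc k) (suc m) ⊕ x m ⊗ offsetSum j k (suc c) m
      ≈⟨ sym (offsetSum-suc j k c m) ⟩
    offsetSum j (suc k) c m ∎

  boardSum≈offsetSum : ∀ j k c m → boardSum (k + j) k c m ≈ offsetSum j k c m
  boardSum≈offsetSum zero zero c m = begin
    boardSum 0 0 c m                             ≈⟨ boardSum-nil c m ⟩
    [ p (c + 0) ]· 1#                            ≈⟨ indicator-cong (p (c + 0)) (sym (compositionSum-nil (suc m))) ⟩
    [ p (c + 0) ]· compositionSum 0 0 (suc m)    ≈⟨ sym (offsetSum-zero 0 c m) ⟩
    offsetSum 0 0 c m ∎
  boardSum≈offsetSum (suc j) zero c m = begin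
    boardSum (suc j) 0 c m                             ≈⟨ boardSum-suc-zero j c m ⟩
    [ p (c + 0) ]· boardSum j 0 0 (suc m)              ≈⟨ indicator-cong (p (c + 0)) (boardSum≈offsetSum j 0 0 (suc m)) ⟩
    [ p (c + 0) ]· offsetSum j 0 0 (suc m)             ≈⟨ indicator-cong (p (c + 0)) (sym (compositionSum-suc j 0 (suc m))) ⟩
    [ p (c + 0) ]· compositionSum (suc j) 0 (suc m)    ≈⟨ sym (offsetSum-zero (suc j) c m) ⟩
    offsetSum (suc j) 0 c m ∎
  boardSum≈offsetSum zero (suc k) c m =
    boardSum≈offsetSum-suc 0 k c m
      (boardSum-short (k + 0) (suc k) 0 (suc m) (s≤s (ℕ.≤-reflexive (ℕ.+-identityʳ k))))
      (boardSum≈offsetSum 0 k (suc c) m)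
  boardSum≈offsetSum (suc j) (suc k) c m =
    boardSum≈offsetSum-suc (suc j) k c m grayFirst (boardSum≈offsetSum (suc j) k (suc c) m)
    where
    grayFirst : boardSum (k + suc j) (suc k) 0 (suc m) ≈ compositionSum (suc j) (suc k) (suc m)
    grayFirst rewrite ℕ.+-suc k j =
      trans (boardSum≈offsetSum j (suc k) 0 (suc m)) (sym (compositionSum-suc j (suc k) (suc m)))

  boardSum-zeroOffset : ∀ L k m →
    boardSum L k 0 m ≈ sumR R (map (λ w → [ (blackCount w ≡ᵇ k) ∧ all p (blackRuns w) ]· weightFrom R x m w) (boards L))
  boardSum-zeroOffset L k m = sumR-cong (boards L) λ w →
    reflexive (≡.cong (λ rs → [ (blackCount w ≡ᵇ k) ∧ all p rs ]· weightFrom R x m w) (addHead-zero w))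

theorem3p2 : {c ℓ : Level} (R : CommutativeSemiring c ℓ) (k n s : ℕ) →
    1 ≤ k → 1 ≤ n → 1 ≤ s →
    (x : ℕ → CommutativeSemiring.Carrier R) →
    CommutativeSemiring._≈_ R (M R s n k x) (tilingSum R s n k x)
theorem3p2 R k (suc j) s _ _ _ x = begin
  M R s (suc j) k x
    ≈⟨ sumR-filter (all (admissible s)) (monomialFrom R x 0) (compositions (suc j) k) ⟩
  compositionSum (suc j) k 0  ≈⟨ compositionSum-suc j k 0 ⟩
  offsetSum j k 0 0           ≈⟨ sym (boardSum≈offsetSum j k 0 0) ⟩
  boardSum (k + j) k 0 0      ≡⟨ ≡.cong (λ L → boardSum L k 0 0) (ℕ.+-comm k j) ⟩
  boardSum (j + k) k 0 0      ≈⟨ boardSum-zeroOffset (j + k) k 0 ⟩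
  sumR R (map (λ w → [ (blackCount w ≡ᵇ k) ∧ all (admissible s) (blackRuns w) ]· ω R x w) (boards (j + k)))
    ≈⟨ sym (sumR-filter _ (ω R x) (boards (j + k))) ⟩
  tilingSum R s (suc j) k x   ∎
  where
  open CommutativeSemiring R using (sym)
  open import Relation.Binary.Reasoning.Setoid (CommutativeSemiring.setoid R)
  open Sums R using (sumR-filter; [_]·_)
  open Tilings R (admissible s) x
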